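{- For every real number $x$ (regular sequence) in $[0,1]$, $x\simeq\Phi(\alpha_x)$.
   Context: The setting is constructive. Real numbers are regular sequences $x=\langle r_n\rangle$ of rationals with $|r_n-r_{n+1}|\le 2^{ -(n+1)}$. Equality is $\langle r_n\rangle\simeq\langle q_n\rangle$ iff $\forall n\,|r_{n+1}-q_{n+1}|\le 2^{ -n}$. Order: $x<y$ iff $\exists n\,(q_{n+1}-r_{n+1}>2^{ -n})$, and $x\le y$ iff $\neg(y<x)$. The unit interval is $[0,1]=\{x:0\le x\le1\}$. For $s\in\{0,1,2\}^*$, define $N(\langle\rangle)=1$ and $N(s*\langle i\rangle)=2N(s)+(i-1)$. For $\alpha\in\{0,1,2\}^{\mathbb{N}}$, $\Phi(\alpha)=\langle 2^{ -(n+1)}N(\overline{\alpha}n)\rangle_n$, where $\overline{\alpha}n$ is the initial segment of length $n$. For $s\in\{0,1,2\}^*$, let $\mathbb{I}_s$ be the rational interval $[2^{ -(|s|+1)}(N(s)-1),\,2^{ -(|s|+1)}(N(s)+1)]$. For rational intervals, $[p,q]\sqsubseteq[p',q']$ means $p'\le p$ and $q\le q'$. Given $x=\langle r_n\rangle$ in $[0,1]$, let $\mathbb{I}^x_n=[\max\{r_{n+3}-2^{ -(n+3)},0\},\,\min\{r_{n+3}+2^{ -(n+3)},1\}]$. Define $\alpha_x\in\{0,1,2\}^{\mathbb{N}}$ by primitive recursion: $\alpha_x(n)$ is the least $i\in\{0,1,2\}$ such that $\mathbb{I}^x_n\sqsubseteq\mathbb{I}_{\langle\alpha_x(0),\dots,\alpha_x(n-1),i\rangle}$.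 (Such an $i$ always exists.) -}

module Defs where

open import Data.Nat as ℕ using (ℕ; zero; suc)
open import Data.Integer as ℤ using (ℤ; +_)
open import Data.Fin using (Fin; zero; suc; toℕ)
open import Data.List using (List; []; _∷_; _++_; foldl; map; upTo; length)
open import Data.Rational using (ℚ; _/_; 0ℚ; 1ℚ; _+_; _-_; _*_; _≤_; _<_; ∣_∣; _⊔_; _⊓_)
open import Data.Rational.Properties using (_≤?_)
open import Data.Product using (Σ; ∃; _×_; _,_; proj₁)
open import Data.Bool using (Bool; true; false; _∧_; if_then_else_)
open import Relation.Nullary using (¬_)
open import Relation.Nullary.Decidable using (⌊_⌋)

half : ℕ → ℚ
half zero    = 1ℚ
half (suc n) = (+ 1 / 2) * half n

ℤtoℚ : ℤ → ℚ
ℤtoℚ z = z / 1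

IsRegular : (ℕ → ℚ) → Set
IsRegular r = ∀ n → ∣ r n - r (suc n) ∣ ≤ half (suc n)

ℝ : Set
ℝ = Σ (ℕ → ℚ) IsRegular

seq : ℝ → ℕ → ℚ
seq = proj₁

_≃_ : (ℕ → ℚ) → (ℕ → ℚ) → Set
r ≃ q = ∀ n → ∣ r (suc n) - q (suc n) ∣ ≤ half n

_<ˢ_ : (ℕ → ℚ) → (ℕ → ℚ) → Set
r <ˢ q = ∃ λ n → half n < q (suc n) - r (suc n)

_≤ˢ_ : (ℕ → ℚ) → (ℕ → ℚ) → Set
r ≤ˢ q = ¬ (q <ˢ r)

0ˢ 1ˢ : ℕ → ℚ
0ˢ _ = 0ℚ
1ˢ _ = 1ℚ

In01 : ℝ → Set
In01 x = (0ˢ ≤ˢ seq x) × (seq x ≤ˢ 1ˢ)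

Digit : Set
Digit = Fin 3

N : List Digit → ℤ
N = foldl (λ acc i → (+ 2) ℤ.* acc ℤ.+ ((+ toℕ i) ℤ.- (+ 1))) (+ 1)

initSeg : (ℕ → Digit) → ℕ → List Digit
initSeg α n = map α (upTo n)

Φ : (ℕ → Digit) → ℕ → ℚ
Φ α n = half (suc n) * ℤtoℚ (N (initSeg α n))

record Interval : Set where
  constructor [_,_]
  field
    lo hi : ℚ

_⊑_ : Interval → Interval → Set
[ p , q ] ⊑ [ p′ , q′ ] = (p′ ≤ p) × (q ≤ q′)

_⊑?_ : Interval → Interval → Bool
[ p , q ] ⊑? [ p′ , q′ ] = ⌊ p′ ≤? p ⌋ ∧ ⌊ q ≤? q′ ⌋

𝕀 : List Digit → Interval
𝕀 s = [ half (suc (length s)) * ℤtoℚ (N s ℤ.- + 1)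
      , half (suc (length s)) * ℤtoℚ (N s ℤ.+ + 1) ]

𝕀ˣ : ℝ → ℕ → Interval
𝕀ˣ x n = [ (seq x (n ℕ.+ 3) - half (n ℕ.+ 3)) ⊔ 0ℚ
         , (seq x (n ℕ.+ 3) + half (n ℕ.+ 3)) ⊓ 1ℚ ]

-- least i ∈ {0,1,2} with J ⊑ 𝕀_{s*⟨i⟩}; defaults to 2 if none (never happens)
leastDigit : Interval → List Digit → Digit
leastDigit J s =
  if J ⊑? 𝕀 (s ++ zero ∷ []) then zero
  else if J ⊑? 𝕀 (s ++ suc zero ∷ []) then suc zero
  else suc (suc zero)

αprefix : ℝ → ℕ → List Digit
αprefix x zero    = []
αprefix x (suc n) = αprefix x n ++ leastDigit (𝕀ˣ x n) (αprefix x n) ∷ []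

α : ℝ → ℕ → Digit
α x n = leastDigit (𝕀ˣ x n) (αprefix x n)

-- The intervals 𝕀ˣ_n are nested and 𝕀ˣ_n has width at most 2^-(n+2), a quarter of the width
-- of a dyadic interval 𝕀_s with |s| = n. An interval that narrow inside 𝕀_s lies in one of the
-- three children 𝕀_{s*i}, the halves of 𝕀_s centred at its midpoint and its two quarter points,
-- so by induction 𝕀ˣ_n ⊑ 𝕀_{ᾱ_x n} and even 𝕀ˣ_n ⊑ 𝕀_{ᾱ_x (n+1)}. The midpoint of the latter
-- is Φ(α_x)_{n+1} and its radius is 2^-(n+2); since r_{n+3} lies within 2^-(n+2) of [0,1] it
-- is within 2^-(n+1) of that midpoint, and regularity moves the estimate from r_{n+3} to r_{n+1}.
module Submission where

open import Defs
open import Data.Nat as ℕ using (ℕ; zero; suc)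
import Data.Nat.Properties as ℕ
open import Data.Integer as ℤ using (ℤ; +_)
import Data.Integer.Properties as ℤ
open import Data.Fin using (zero; suc; toℕ)
open import Data.List using (List; []; _∷_; _∷ʳ_; length; map; upTo)
open import Data.List.Properties using (length-++; foldl-++; upTo-∷ʳ; map-++)
open import Data.Rational
  using (ℚ; 0ℚ; 1ℚ; ½; _+_; _-_; _*_; -_; _≤_; ∣_∣; _⊔_; _⊓_; toℚᵘ; *≤*)
open import Data.Rational.Properties
import Data.Rational.Unnormalised as ℚᵘ
import Data.Rational.Unnormalised.Properties as ℚᵘ
open import Data.Rational.Solver using (module +-*-Solver)
open +-*-Solver using (solve; _:+_; _:-_; _:*_; :-_; _:=_; con)
open import Data.Product using (∃; _×_; _,_; proj₁; proj₂)
open import Data.Sum using (inj₁; inj₂)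
open import Data.Bool using (if_then_else_)
open import Data.Empty using (⊥-elim)
open import Relation.Nullary using (yes; no)
open import Relation.Nullary.Reflects using (Reflects; ofʸ; ofⁿ)
open import Relation.Binary.PropositionalEquality
  using (_≡_; refl; sym; trans; cong; cong₂; subst; subst₂; module ≡-Reasoning)

open Interval

ℤtoℚ-+ : ∀ a b → ℤtoℚ (a ℤ.+ b) ≡ ℤtoℚ a + ℤtoℚ b
ℤtoℚ-+ a b = toℚᵘ-injective (begin-equality
  toℚᵘ (ℤtoℚ (a ℤ.+ b))                ≃⟨ toℚᵘ-fromℚᵘ (ℚᵘ.mkℚᵘ (a ℤ.+ b) 0) ⟩
  ℚᵘ.mkℚᵘ (a ℤ.+ b) 0                  ≃⟨ ℚᵘ.*≡* (cong (ℤ._* + 1) (sym (cong₂ ℤ._+_ (ℤ.*-identityʳ a) (ℤ.*-identityʳ b)))) ⟩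
  ℚᵘ.mkℚᵘ a 0 ℚᵘ.+ ℚᵘ.mkℚᵘ b 0         ≃⟨ ℚᵘ.+-cong (toℚᵘ-fromℚᵘ (ℚᵘ.mkℚᵘ a 0)) (toℚᵘ-fromℚᵘ (ℚᵘ.mkℚᵘ b 0)) ⟨
  toℚᵘ (ℤtoℚ a) ℚᵘ.+ toℚᵘ (ℤtoℚ b)     ≃⟨ toℚᵘ-homo-+ (ℤtoℚ a) (ℤtoℚ b) ⟨
  toℚᵘ (ℤtoℚ a + ℤtoℚ b)               ∎)
  where open ℚᵘ.≤-Reasoning

ℤtoℚ-* : ∀ a b → ℤtoℚ (a ℤ.* b) ≡ ℤtoℚ a * ℤtoℚ b
ℤtoℚ-* a b = toℚᵘ-injective (begin-equality
  toℚᵘ (ℤtoℚ (a ℤ.* b))                ≃⟨ toℚᵘ-fromℚᵘ (ℚᵘ.mkℚᵘ (a ℤ.* b) 0) ⟩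
  ℚᵘ.mkℚᵘ a 0 ℚᵘ.* ℚᵘ.mkℚᵘ b 0         ≃⟨ ℚᵘ.*-cong (toℚᵘ-fromℚᵘ (ℚᵘ.mkℚᵘ a 0)) (toℚᵘ-fromℚᵘ (ℚᵘ.mkℚᵘ b 0)) ⟨
  toℚᵘ (ℤtoℚ a) ℚᵘ.* toℚᵘ (ℤtoℚ b)     ≃⟨ toℚᵘ-homo-* (ℤtoℚ a) (ℤtoℚ b) ⟨
  toℚᵘ (ℤtoℚ a * ℤtoℚ b)               ∎)
  where open ℚᵘ.≤-Reasoning

p≤q+r⇒p-q≤r : ∀ {p q r} → p ≤ q + r → p - q ≤ r
p≤q+r⇒p-q≤r {p} {q} {r} p≤q+r = begin
  p - q        ≤⟨ +-monoˡ-≤ (- q) p≤q+r ⟩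
  q + r - q    ≡⟨ solve 2 (λ q r → q :+ r :- q := r) refl q r ⟩
  r            ∎
  where open ≤-Reasoning

p-q≤r⇒p≤q+r : ∀ {p q r} → p - q ≤ r → p ≤ q + r
p-q≤r⇒p≤q+r {p} {q} {r} p-q≤r = begin
  p            ≡⟨ solve 2 (λ p q → p := q :+ (p :- q)) refl p q ⟩
  q + (p - q)  ≤⟨ +-monoʳ-≤ q p-q≤r ⟩
  q + r        ∎
  where open ≤-Reasoning

p≤p+q : ∀ p {q} → 0ℚ ≤ q → p ≤ p + q
p≤p+q p {q} 0≤q = subst (_≤ p + q) (+-identityʳ p) (+-monoʳ-≤ p 0≤q)

p-q≤p : ∀ p {q} → 0ℚ ≤ q → p - q ≤ p
p-q≤p p {q} 0≤q = p≤q+r⇒p-q≤r (subst (p ≤_) (+-comm p q) (p≤p+q p 0≤q))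

p≤∣p∣ : ∀ p → p ≤ ∣ p ∣
p≤∣p∣ p with ∣p∣≡p∨∣p∣≡-p p
... | inj₁ ∣p∣≡p  = ≤-reflexive (sym ∣p∣≡p)
... | inj₂ ∣p∣≡-p = begin
  p          ≡⟨ +-identityʳ p ⟨
  p + 0ℚ     ≤⟨ +-monoʳ-≤ p 0≤-p ⟩
  p + - p    ≡⟨ +-inverseʳ p ⟩
  0ℚ         ≤⟨ 0≤-p ⟩
  - p        ≡⟨ ∣p∣≡-p ⟨
  ∣ p ∣      ∎
  where
  open ≤-Reasoning
  0≤-p : 0ℚ ≤ - p
  0≤-p = subst (0ℚ ≤_) ∣p∣≡-p (0≤∣p∣ p)

∣p-q∣≡∣q-p∣ : ∀ p q → ∣ p - q ∣ ≡ ∣ q - p ∣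
∣p-q∣≡∣q-p∣ p q = trans (sym (∣-p∣≡∣p∣ (p - q))) (cong ∣_∣ (solve 2 (λ p q → :- (p :- q) := q :- p) refl p q))

∣p-q∣≤r⇒p≤q+r : ∀ {p q r} → ∣ p - q ∣ ≤ r → p ≤ q + r
∣p-q∣≤r⇒p≤q+r {p} {q} ∣p-q∣≤r = p-q≤r⇒p≤q+r (≤-trans (p≤∣p∣ (p - q)) ∣p-q∣≤r)

∣p-q∣≤r⇒q≤p+r : ∀ {p q r} → ∣ p - q ∣ ≤ r → q ≤ p + r
∣p-q∣≤r⇒q≤p+r {p} {q} ∣p-q∣≤r = ∣p-q∣≤r⇒p≤q+r (subst (_≤ _) (∣p-q∣≡∣q-p∣ p q) ∣p-q∣≤r)

p≤q+r∧q≤p+r⇒∣p-q∣≤r : ∀ {p q r} → p ≤ q + r → q ≤ p + r → ∣ p - q ∣ ≤ r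
p≤q+r∧q≤p+r⇒∣p-q∣≤r {p} {q} p≤q+r q≤p+r with ∣p∣≡p∨∣p∣≡-p (p - q)
... | inj₁ ∣p-q∣≡p-q  = subst (_≤ _) (sym ∣p-q∣≡p-q) (p≤q+r⇒p-q≤r p≤q+r)
... | inj₂ ∣p-q∣≡-[p-q] = subst (_≤ _) (sym ∣p-q∣≡q-p) (p≤q+r⇒p-q≤r q≤p+r)
  where
  ∣p-q∣≡q-p : ∣ p - q ∣ ≡ q - p
  ∣p-q∣≡q-p = trans ∣p-q∣≡-[p-q] (solve 2 (λ p q → :- (p :- q) := q :- p) refl p q)

∣p-r∣≤∣p-q∣+∣q-r∣ : ∀ p q r → ∣ p - r ∣ ≤ ∣ p - q ∣ + ∣ q - r ∣
∣p-r∣≤∣p-q∣+∣q-r∣ p q r = subst (λ d → ∣ d ∣ ≤ ∣ p - q ∣ + ∣ q - r ∣)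
  (solve 3 (λ p q r → (p :- q) :+ (q :- r) := p :- r) refl p q r) (∣p+q∣≤∣p∣+∣q∣ (p - q) (q - r))

half-halves : ∀ n → half n ≡ half (suc n) + half (suc n)
half-halves n = solve 1 (λ h → h := con ½ :* h :+ con ½ :* h) refl (half n)

0≤half : ∀ n → 0ℚ ≤ half n
0≤half zero    = *≤* (ℤ.+≤+ ℕ.z≤n)
0≤half (suc n) = *-monoˡ-≤-nonNeg ½ (0≤half n)

half-suc≤half : ∀ n → half (suc n) ≤ half n
half-suc≤half n = subst (half (suc n) ≤_) (sym (half-halves n)) (p≤p+q (half (suc n)) (0≤half (suc n)))

⊑-trans : ∀ {J K L} → J ⊑ K → K ⊑ L → J ⊑ L
⊑-trans (lo≤ , ≤hi) (lo≤′ , ≤hi′) = ≤-trans lo≤′ lo≤ , ≤-trans ≤hi ≤hi′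

⊑?-reflects : ∀ J K → Reflects (J ⊑ K) (J ⊑? K)
⊑?-reflects J K with lo K ≤? lo J | hi J ≤? hi K
... | yes lo≤ | yes ≤hi = ofʸ (lo≤ , ≤hi)
... | yes _   | no ≰hi  = ofⁿ λ (_ , ≤hi) → ≰hi ≤hi
... | no ≰lo  | _       = ofⁿ λ (lo≤ , _) → ≰lo lo≤

least-of-three : ∀ {P : Digit → Set} {b₀ b₁} → Reflects (P zero) b₀ → Reflects (P (suc zero)) b₁ →
                 ∃ P → P (if b₀ then zero else if b₁ then suc zero else suc (suc zero))
least-of-three (ofʸ p₀)  _          _                    = p₀
least-of-three (ofⁿ _)   (ofʸ p₁)   _                    = p₁
least-of-three (ofⁿ ¬p₀) (ofⁿ _)    (zero , p₀)          = ⊥-elim (¬p₀ p₀)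
least-of-three (ofⁿ _)   (ofⁿ ¬p₁)  (suc zero , p₁)      = ⊥-elim (¬p₁ p₁)
least-of-three (ofⁿ _)   (ofⁿ _)    (suc (suc zero) , p) = p

leastDigit-correct : ∀ J s → ∃ (λ i → J ⊑ 𝕀 (s ∷ʳ i)) → J ⊑ 𝕀 (s ∷ʳ leastDigit J s)
leastDigit-correct J s = least-of-three (⊑?-reflects J _) (⊑?-reflects J _)

ball : ℚ → ℚ → Interval
ball c δ = [ c - δ , c + δ ]

-- The digit i ∈ {0,1,2} contributes i - 1 to N (s * ⟨i⟩) = 2 N(s) + (i - 1).
signed : Digit → ℤ
signed i = + toℕ i ℤ.- + 1

ball-split : ∀ {J m w} → J ⊑ ball m (w + w) → hi J ≤ lo J + w →
             ∃ λ i → J ⊑ ball (m + ℤtoℚ (signed i) * w) w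
ball-split {J} {m} {w} (m-2w≤a , b≤m+2w) b≤a+w with hi J ≤? m | hi J ≤? m + w
... | yes b≤m | _ = zero , subst (J ⊑_) (sym left) (m-2w≤a , b≤m)
  where
  left : ball (m + ℤtoℚ (signed zero) * w) w ≡ [ m - (w + w) , m ]
  left = cong₂ [_,_] (solve 2 (λ m w → m :+ con (ℤtoℚ (signed zero)) :* w :- w := m :- (w :+ w)) refl m w)
                     (solve 2 (λ m w → m :+ con (ℤtoℚ (signed zero)) :* w :+ w := m) refl m w)
... | no b≰m | yes b≤m+w = suc zero , subst (J ⊑_) (sym centre) (m-w≤a , b≤m+w)
  where
  centre : ball (m + ℤtoℚ (signed (suc zero)) * w) w ≡ [ m - w , m + w ]
  centre = cong₂ [_,_] (solve 2 (λ m w → m :+ con (ℤtoℚ (signed (suc zero))) :* w :- w := m :- w) refl m w)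
                       (solve 2 (λ m w → m :+ con (ℤtoℚ (signed (suc zero))) :* w :+ w := m :+ w) refl m w)
  m-w≤a : m - w ≤ lo J
  m-w≤a = p≤q+r⇒p-q≤r (≤-trans (<⇒≤ (≰⇒> b≰m)) (subst (hi J ≤_) (+-comm (lo J) w) b≤a+w))
... | no _ | no b≰m+w = suc (suc zero) , subst (J ⊑_) (sym right) (m+w-w≤a , b≤m+2w)
  where
  right : ball (m + ℤtoℚ (signed (suc (suc zero))) * w) w ≡ [ m + w - w , m + (w + w) ]
  right = cong₂ [_,_] (solve 2 (λ m w → m :+ con (ℤtoℚ (signed (suc (suc zero)))) :* w :- w := m :+ w :- w) refl m w)
                      (solve 2 (λ m w → m :+ con (ℤtoℚ (signed (suc (suc zero)))) :* w :+ w := m :+ (w :+ w)) refl m w)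
  m+w-w≤a : m + w - w ≤ lo J
  m+w-w≤a = p≤q+r⇒p-q≤r (≤-trans (<⇒≤ (≰⇒> b≰m+w)) (subst (hi J ≤_) (+-comm (lo J) w) b≤a+w))

length-∷ʳ : ∀ (s : List Digit) i → length (s ∷ʳ i) ≡ suc (length s)
length-∷ʳ s i = trans (length-++ s) (ℕ.+-comm (length s) 1)

N-∷ʳ : ∀ s i → N (s ∷ʳ i) ≡ + 2 ℤ.* N s ℤ.+ signed i
N-∷ʳ s i = foldl-++ _ (+ 1) s (i ∷ [])

mid : List Digit → ℚ
mid s = half (suc (length s)) * ℤtoℚ (N s)

𝕀≡ball : ∀ s → 𝕀 s ≡ ball (mid s) (half (suc (length s)))
𝕀≡ball s = cong₂ [_,_]
  (trans (cong (h *_) (ℤtoℚ-+ (N s) (ℤ.- + 1)))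
         (solve 2 (λ h c → h :* (c :+ con (ℤtoℚ (ℤ.- + 1))) := h :* c :- h) refl h (ℤtoℚ (N s))))
  (trans (cong (h *_) (ℤtoℚ-+ (N s) (+ 1)))
         (solve 2 (λ h c → h :* (c :+ con (ℤtoℚ (+ 1))) := h :* c :+ h) refl h (ℤtoℚ (N s))))
  where h = half (suc (length s))

mid-∷ʳ : ∀ s i → mid (s ∷ʳ i) ≡ mid s + ℤtoℚ (signed i) * half (2 ℕ.+ length s)
mid-∷ʳ s i = begin
  half (suc (length (s ∷ʳ i))) * ℤtoℚ (N (s ∷ʳ i))  ≡⟨ cong₂ (λ k n → half (suc k) * ℤtoℚ n) (length-∷ʳ s i) (N-∷ʳ s i) ⟩
  w * ℤtoℚ (+ 2 ℤ.* N s ℤ.+ signed i)               ≡⟨ cong (w *_) (ℤtoℚ-+ (+ 2 ℤ.* N s) (signed i)) ⟩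
  w * (ℤtoℚ (+ 2 ℤ.* N s) + d)                      ≡⟨ cong (λ e → w * (e + d)) (ℤtoℚ-* (+ 2) (N s)) ⟩
  w * (ℤtoℚ (+ 2) * c + d)                          ≡⟨ solve 3 (λ w c d → w :* (con (ℤtoℚ (+ 2)) :* c :+ d) := (w :+ w) :* c :+ d :* w) refl w c d ⟩
  (w + w) * c + d * w                               ≡⟨ cong (λ h → h * c + d * w) (half-halves (suc (length s))) ⟨
  mid s + d * w                                     ∎
  where
  open ≡-Reasoning
  w = half (2 ℕ.+ length s)
  c = ℤtoℚ (N s)
  d = ℤtoℚ (signed i)

𝕀-∷ʳ≡ball : ∀ s i → 𝕀 (s ∷ʳ i) ≡ ball (mid s + ℤtoℚ (signed i) * half (2 ℕ.+ length s)) (half (2 ℕ.+ length s))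
𝕀-∷ʳ≡ball s i = trans (𝕀≡ball (s ∷ʳ i)) (cong₂ ball (mid-∷ʳ s i) (cong (λ k → half (suc k)) (length-∷ʳ s i)))

refine : ∀ J s → J ⊑ 𝕀 s → hi J ≤ lo J + half (2 ℕ.+ length s) → J ⊑ 𝕀 (s ∷ʳ leastDigit J s)
refine J s J⊑𝕀s narrow = leastDigit-correct J s (child (ball-split {m = mid s} J⊑ball narrow))
  where
  w = half (2 ℕ.+ length s)
  J⊑ball : J ⊑ ball (mid s) (w + w)
  J⊑ball = subst (J ⊑_) (trans (𝕀≡ball s) (cong (ball (mid s)) (half-halves (suc (length s))))) J⊑𝕀s
  child : (∃ λ i → J ⊑ ball (mid s + ℤtoℚ (signed i) * w) w) → ∃ λ i → J ⊑ 𝕀 (s ∷ʳ i)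
  child (i , J⊑) = i , subst (J ⊑_) (sym (𝕀-∷ʳ≡ball s i)) J⊑

clamp : ℚ → ℚ → Interval
clamp r ε = [ (r - ε) ⊔ 0ℚ , (r + ε) ⊓ 1ℚ ]

clamp⊑unit : ∀ r ε → clamp r ε ⊑ [ 0ℚ , 1ℚ ]
clamp⊑unit r ε = p≤q⊔p (r - ε) 0ℚ , p⊓q≤q (r + ε) 1ℚ

clamp-narrow : ∀ r ε → hi (clamp r ε) ≤ lo (clamp r ε) + (ε + ε)
clamp-narrow r ε = begin
  (r + ε) ⊓ 1ℚ          ≤⟨ p⊓q≤p (r + ε) 1ℚ ⟩
  r + ε                 ≡⟨ solve 2 (λ r ε → r :+ ε := r :- ε :+ (ε :+ ε)) refl r ε ⟩
  r - ε + (ε + ε)       ≤⟨ +-monoˡ-≤ (ε + ε) (p≤p⊔q (r - ε) 0ℚ) ⟩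
  (r - ε) ⊔ 0ℚ + (ε + ε) ∎
  where open ≤-Reasoning

clamp⊑clamp : ∀ {r r′ ε} → ∣ r - r′ ∣ ≤ ε → clamp r′ ε ⊑ clamp r (ε + ε)
clamp⊑clamp {r} {r′} {ε} ∣r-r′∣≤ε = ⊔-monoˡ-≤ 0ℚ lo≤ , ⊓-monoˡ-≤ 1ℚ ≤hi
  where
  open ≤-Reasoning
  lo≤ : r - (ε + ε) ≤ r′ - ε
  lo≤ = begin
    r - (ε + ε)         ≤⟨ +-monoˡ-≤ (- (ε + ε)) (∣p-q∣≤r⇒p≤q+r {r} {r′} ∣r-r′∣≤ε) ⟩
    r′ + ε - (ε + ε)    ≡⟨ solve 2 (λ r′ ε → r′ :+ ε :- (ε :+ ε) := r′ :- ε) refl r′ ε ⟩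
    r′ - ε              ∎
  ≤hi : r′ + ε ≤ r + (ε + ε)
  ≤hi = begin
    r′ + ε              ≤⟨ +-monoˡ-≤ ε (∣p-q∣≤r⇒q≤p+r {r} {r′} ∣r-r′∣≤ε) ⟩
    r + ε + ε           ≡⟨ +-assoc r ε ε ⟩
    r + (ε + ε)         ∎

clamp⊑ball⇒∣r-c∣≤ : ∀ {r ε η c δ} → 0ℚ ≤ ε → 0ℚ ≤ η → 0ℚ - r ≤ η → r - 1ℚ ≤ η →
                    clamp r ε ⊑ ball c δ → ∣ r - c ∣ ≤ δ + η
clamp⊑ball⇒∣r-c∣≤ {r} {ε} {η} {c} {δ} 0≤ε 0≤η -r≤η r-1≤η (c-δ≤lo , hi≤c+δ) =
  p≤q+r∧q≤p+r⇒∣p-q∣≤r r≤c+δ+η c≤r+δ+η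
  where
  open ≤-Reasoning
  r-η≤hi : r - η ≤ (r + ε) ⊓ 1ℚ
  r-η≤hi = ⊓-glb (≤-trans (p-q≤p r 0≤η) (p≤p+q r 0≤ε))
                 (p≤q+r⇒p-q≤r {r} {η} (subst (r ≤_) (+-comm 1ℚ η) (p-q≤r⇒p≤q+r {r} {1ℚ} r-1≤η)))
  lo≤r+η : (r - ε) ⊔ 0ℚ ≤ r + η
  lo≤r+η = ⊔-lub (≤-trans (p-q≤p r 0≤ε) (p≤p+q r 0≤η))
                 (subst (_≤ r + η) (+-identityʳ 0ℚ) (p-q≤r⇒p≤q+r {0ℚ} {r} -r≤η))
  r≤c+δ+η : r ≤ c + (δ + η)
  r≤c+δ+η = begin
    r                   ≡⟨ solve 2 (λ r η → r := r :- η :+ η) refl r η ⟩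
    r - η + η           ≤⟨ +-monoˡ-≤ η (≤-trans r-η≤hi hi≤c+δ) ⟩
    c + δ + η           ≡⟨ +-assoc c δ η ⟩
    c + (δ + η)         ∎
  c≤r+δ+η : c ≤ r + (δ + η)
  c≤r+δ+η = begin
    c                   ≡⟨ solve 2 (λ c δ → c := c :- δ :+ δ) refl c δ ⟩
    c - δ + δ           ≤⟨ +-monoˡ-≤ δ (≤-trans c-δ≤lo lo≤r+η) ⟩
    r + η + δ           ≡⟨ solve 3 (λ r η δ → r :+ η :+ δ := r :+ (δ :+ η)) refl r η δ ⟩
    r + (δ + η)         ∎

𝕀ˣ≡clamp : ∀ x n → 𝕀ˣ x n ≡ clamp (seq x (3 ℕ.+ n)) (half (3 ℕ.+ n))
𝕀ˣ≡clamp x n = cong (λ k → clamp (seq x k) (half k)) (ℕ.+-comm n 3)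

𝕀ˣ-nested : ∀ x n → 𝕀ˣ x (suc n) ⊑ 𝕀ˣ x n
𝕀ˣ-nested x n = subst (λ ε → 𝕀ˣ x (suc n) ⊑ clamp (seq x k) ε) (sym (half-halves k))
                      (clamp⊑clamp {seq x k} {seq x (suc k)} (proj₂ x k))
  where k = n ℕ.+ 3

𝕀ˣ-narrow : ∀ x n → hi (𝕀ˣ x n) ≤ lo (𝕀ˣ x n) + half (2 ℕ.+ n)
𝕀ˣ-narrow x n = subst (λ w → hi (𝕀ˣ x n) ≤ lo (𝕀ˣ x n) + w) (sym halves) (clamp-narrow (seq x k) (half k))
  where
  k = n ℕ.+ 3
  halves : half (2 ℕ.+ n) ≡ half k + half k
  halves = trans (half-halves (2 ℕ.+ n)) (cong (λ j → half j + half j) (ℕ.+-comm 3 n))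

αprefix-length : ∀ x n → length (αprefix x n) ≡ n
αprefix-length x zero    = refl
αprefix-length x (suc n) = trans (length-∷ʳ (αprefix x n) _) (cong suc (αprefix-length x n))

𝕀ˣ⊑𝕀-αprefix : ∀ x n → 𝕀ˣ x n ⊑ 𝕀 (αprefix x n)
𝕀ˣ⊑𝕀-αprefix-suc : ∀ x n → 𝕀ˣ x n ⊑ 𝕀 (αprefix x (suc n))

𝕀ˣ⊑𝕀-αprefix x zero    = clamp⊑unit (seq x 3) (half 3)
𝕀ˣ⊑𝕀-αprefix x (suc n) = ⊑-trans (𝕀ˣ-nested x n) (𝕀ˣ⊑𝕀-αprefix-suc x n)

𝕀ˣ⊑𝕀-αprefix-suc x n = refine (𝕀ˣ x n) (αprefix x n) (𝕀ˣ⊑𝕀-αprefix x n)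
  (subst (λ k → hi (𝕀ˣ x n) ≤ lo (𝕀ˣ x n) + half (2 ℕ.+ k)) (sym (αprefix-length x n)) (𝕀ˣ-narrow x n))

initSeg-α : ∀ x n → initSeg (α x) n ≡ αprefix x n
initSeg-α x zero    = refl
initSeg-α x (suc n) = begin
  map (α x) (upTo (suc n))            ≡⟨ cong (map (α x)) (upTo-∷ʳ n) ⟨
  map (α x) (upTo n ∷ʳ n)             ≡⟨ map-++ (α x) (upTo n) (n ∷ []) ⟩
  initSeg (α x) n ∷ʳ α x n            ≡⟨ cong (_∷ʳ α x n) (initSeg-α x n) ⟩
  αprefix x n ∷ʳ α x n                ∎
  where open ≡-Reasoning

𝕀-αprefix≡ball : ∀ x n → 𝕀 (αprefix x n) ≡ ball (Φ (α x) n) (half (suc n))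
𝕀-αprefix≡ball x n = trans (𝕀≡ball (αprefix x n))
  (cong₂ ball (sym Φ≡mid) (cong (λ k → half (suc k)) (αprefix-length x n)))
  where
  Φ≡mid : Φ (α x) n ≡ mid (αprefix x n)
  Φ≡mid = cong₂ (λ k t → half (suc k) * ℤtoℚ (N t)) (sym (αprefix-length x n)) (initSeg-α x n)

In01⇒near : ∀ x → In01 x → ∀ k → (0ℚ - seq x (suc k) ≤ half k) × (seq x (suc k) - 1ℚ ≤ half k)
In01⇒near x (0≤x , x≤1) k = ≮⇒≥ (λ < → 0≤x (k , <)) , ≮⇒≥ (λ < → x≤1 (k , <))

∣xₙ-xₙ₊₂∣≤ : ∀ (x : ℝ) n → ∣ seq x n - seq x (2 ℕ.+ n) ∣ ≤ half (1 ℕ.+ n) + half (2 ℕ.+ n)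
∣xₙ-xₙ₊₂∣≤ (r , reg) n =
  ≤-trans (∣p-r∣≤∣p-q∣+∣q-r∣ (r n) (r (suc n)) (r (2 ℕ.+ n))) (+-mono-≤ (reg n) (reg (suc n)))

proposition4p3 : (x : ℝ) → In01 x → seq x ≃ Φ (α x)
proposition4p3 x x∈[0,1] n = begin
  ∣ r (1 ℕ.+ n) - P ∣                          ≤⟨ ∣p-r∣≤∣p-q∣+∣q-r∣ (r (1 ℕ.+ n)) (r (3 ℕ.+ n)) P ⟩
  ∣ r (1 ℕ.+ n) - r (3 ℕ.+ n) ∣ + ∣ r (3 ℕ.+ n) - P ∣
                                               ≤⟨ +-mono-≤ (∣xₙ-xₙ₊₂∣≤ x (1 ℕ.+ n)) ∣r₃₊ₙ-P∣≤ ⟩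
  (h₂ + half (3 ℕ.+ n)) + (h₂ + h₂)            ≤⟨ +-monoˡ-≤ (h₂ + h₂) (+-monoʳ-≤ h₂ (half-suc≤half (2 ℕ.+ n))) ⟩
  (h₂ + h₂) + (h₂ + h₂)                        ≡⟨ cong (λ h → h + h) (half-halves (1 ℕ.+ n)) ⟨
  half (1 ℕ.+ n) + half (1 ℕ.+ n)              ≡⟨ half-halves n ⟨
  half n                                       ∎
  where
  open ≤-Reasoning
  r = seq x
  P = Φ (α x) (suc n)
  h₂ = half (2 ℕ.+ n)
  ∣r₃₊ₙ-P∣≤ : ∣ r (3 ℕ.+ n) - P ∣ ≤ h₂ + h₂
  ∣r₃₊ₙ-P∣≤ = clamp⊑ball⇒∣r-c∣≤ {r (3 ℕ.+ n)} {c = P} {δ = h₂} (0≤half (3 ℕ.+ n)) (0≤half (2 ℕ.+ n))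
            (proj₁ (In01⇒near x x∈[0,1] (2 ℕ.+ n))) (proj₂ (In01⇒near x x∈[0,1] (2 ℕ.+ n)))
            (subst₂ _⊑_ (𝕀ˣ≡clamp x n) (𝕀-αprefix≡ball x (suc n)) (𝕀ˣ⊑𝕀-αprefix-suc x n))
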